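{- Let $\mathbf{ILX}$ be a logic extending $\mathbf{IL}$ that contains every instance of $\mathsf P$: $A\rhd B\to\Box(A\rhd B)$. For $\mathbf{ILX}$-MCSs $\Gamma,\Lambda,\Delta$ and sets of formulas $S,T$: if $\Gamma\prec_S\Lambda\prec_T\Delta$ then $\Gamma\prec_{S\cup\Lambda^{\boxdot}_T}\Delta$.
   Context: Formulas: $\bot$, propositional variables, $\to$, $\Box$, binary $\rhd$; $\Diamond A:=\neg\Box\neg A$. $\mathbf{IL}$: classical tautologies, K, L: $\Box(\Box A\to A)\to\Box A$, J1: $\Box(A\to B)\to A\rhd B$, J2: $(A\rhd B)\wedge(B\rhd C)\to A\rhd C$, J3: $(A\rhd C)\wedge(B\rhd C)\to A\vee B\rhd C$, J4: $A\rhd B\to(\Diamond A\to\Diamond B)$, J5: $\Diamond A\rhd A$; rules modus ponens and necessitation. An $\mathbf{ILX}$-MCS is a maximal $\mathbf{ILX}$-consistent set. $\Gamma\prec_S\Delta$ iff for every formula $A$ and finite $S'\subseteq S$, $\neg A\rhd\bigvee_{\sigma\in S'}\neg\sigma\in\Gamma$ implies $A,\Box A\in\Delta$ (empty disjunction is $\bot$). $\Lambda^{\boxdot}_T=\{A,\Box A:\neg A\rhd\bigvee_{\sigma\in T'}\neg\sigma\in\Lambda$ for some finite $T'\subseteq T\}$. -}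

module Defs where

open import Data.Nat using (ℕ)
open import Data.Bool using (Bool; true; false; if_then_else_)
open import Data.List using (List; []; _∷_; foldr)
open import Data.List.Relation.Unary.All using (All)
open import Data.Product using (Σ; _×_; ∃)
open import Data.Sum using (_⊎_)
open import Relation.Binary.PropositionalEquality using (_≡_)

infixr 5 _⇒_
infix 6 _▷_

data Formula : Set where
  ⊥'  : Formula
  var : ℕ → Formula
  _⇒_ : Formula → Formula → Formula
  □   : Formula → Formula
  _▷_ : Formula → Formula → Formula

¬' : Formula → Formula
¬' A = A ⇒ ⊥'

⊤' : Formula
⊤' = ¬' ⊥'

_∨'_ : Formula → Formula → Formula
A ∨' B = ¬' A ⇒ B

_∧'_ : Formula → Formula → Formula
A ∧' B = ¬' (A ⇒ ¬' B)

◇ : Formula → Formula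
◇ A = ¬' (□ (¬' A))

FSet : Set₁
FSet = Formula → Set

_∈_ : Formula → FSet → Set
A ∈ S = S A

_⊆_ : FSet → FSet → Set
S ⊆ S' = ∀ A → A ∈ S → A ∈ S'

_∪_ : FSet → FSet → FSet
(S ∪ S') A = S A ⊎ S' A

-- classical tautologies: formulas true under every Boolean valuation that
-- treats □- and ▷-formulas (and variables) as atoms
evalB : (Formula → Bool) → Formula → Bool
evalB v ⊥' = false
evalB v (var n) = v (var n)
evalB v (A ⇒ B) = if evalB v A then evalB v B else true
evalB v (□ A) = v (□ A)
evalB v (A ▷ B) = v (A ▷ B)

Tautology : Formula → Set
Tautology A = ∀ (v : Formula → Bool) → evalB v A ≡ true

record ExtendsIL (X : FSet) : Set where
  field
    taut : ∀ A → Tautology A → A ∈ X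
    K    : ∀ A B → (□ (A ⇒ B) ⇒ (□ A ⇒ □ B)) ∈ X
    L    : ∀ A → (□ (□ A ⇒ A) ⇒ □ A) ∈ X
    J1   : ∀ A B → (□ (A ⇒ B) ⇒ A ▷ B) ∈ X
    J2   : ∀ A B C → ((A ▷ B) ∧' (B ▷ C) ⇒ A ▷ C) ∈ X
    J3   : ∀ A B C → ((A ▷ C) ∧' (B ▷ C) ⇒ (A ∨' B) ▷ C) ∈ X
    J4   : ∀ A B → (A ▷ B ⇒ (◇ A ⇒ ◇ B)) ∈ X
    J5   : ∀ A → (◇ A ▷ A) ∈ X
    MP   : ∀ A B → (A ⇒ B) ∈ X → A ∈ X → B ∈ X
    Nec  : ∀ A → A ∈ X → □ A ∈ X

ContainsP : FSet → Set
ContainsP X = ∀ A B → (A ▷ B ⇒ □ (A ▷ B)) ∈ X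

⋀ : List Formula → Formula
⋀ = foldr _∧'_ ⊤'

⋁¬ : List Formula → Formula
⋁¬ = foldr (λ σ acc → ¬' σ ∨' acc) ⊥'

Consistent : FSet → FSet → Set
Consistent X Γ = (Γ' : List Formula) → All (_∈ Γ) Γ' → (⋀ Γ' ⇒ ⊥') ∈ X → Data.Empty.⊥
  where import Data.Empty

MCS : FSet → FSet → Set₁
MCS X Γ = Consistent X Γ × (∀ (Γ' : FSet) → Γ ⊆ Γ' → Consistent X Γ' → Γ' ⊆ Γ)

_≺[_]_ : FSet → FSet → FSet → Set
Γ ≺[ S ] Δ = ∀ (A : Formula) (S' : List Formula) → All (_∈ S) S' →
  (¬' A ▷ ⋁¬ S') ∈ Γ → (A ∈ Δ) × (□ A ∈ Δ)

boxdot : FSet → FSet → FSet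
boxdot Λ T B = Σ Formula λ A → Σ (List Formula) λ T' →
  All (_∈ T) T' × ((¬' A ▷ ⋁¬ T') ∈ Λ) × ((B ≡ A) ⊎ (B ≡ □ A))

module Submission where

-- Suppose Γ ≺_S Λ ≺_T Δ and ¬A ▷ ⋁_{σ∈S'} ¬σ ∈ Γ with
-- S' ⊆ S ∪ Λ^⊡_T finite.  By axiom P the formula is boxed in Γ, hence it lies in
-- Λ.  Every σ ∈ S' "reduces" in Λ: ¬σ ▷ ⋁¬T_σ ∈ Λ for a finite T_σ ⊆ T.  For
-- σ ∈ S this holds with T_σ = ∅ because □σ ∈ Λ; for σ = B ∈ Λ^⊡_T it is the
-- defining formula; for σ = □B use ¬□B ▷ ◇¬B ▷ ¬B (J1 and J5).  Joining these by
-- J3 gives ⋁_{σ∈S'} ¬σ ▷ ⋁¬(⋃T_σ) ∈ Λ, so by J2 ¬A ▷ ⋁¬(⋃T_σ) ∈ Λ, and Λ ≺_T Δ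
-- yields A, □A ∈ Δ.

open import Defs
open import Data.Bool using (Bool; true; false; if_then_else_; _≟_)
open import Data.Empty using (⊥; ⊥-elim)
open import Data.List using (List; []; _∷_; _++_)
open import Data.List.Relation.Unary.All using (All; []; _∷_)
import Data.List.Relation.Unary.All as All
import Data.List.Relation.Unary.All.Properties as All
open import Data.List.Relation.Unary.Any using (Any; here; there)
import Data.List.Relation.Unary.Any.Properties as Any
open import Data.Product using (Σ; _×_; _,_; proj₁; proj₂)
open import Data.Sum using (_⊎_; inj₁; inj₂)
open import Relation.Nullary using (¬_; Dec; yes; no)
open import Relation.Binary.PropositionalEquality using (_≡_; refl)

-- A formula holds under a valuation (□- and ▷-formulas are atoms).  It is a
-- record so that the formula can be inferred from the type.
record Holds (v : Formula → Bool) (A : Formula) : Set where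
  constructor holds
  field truth : evalB v A ≡ true

infix 4 _⊨_
_⊨_ : List Formula → Formula → Set
L ⊨ B = ∀ v → All (Holds v) L → Holds v B

module _ {v : Formula → Bool} where

  ⊥-fails : ¬ Holds v ⊥'
  ⊥-fails (holds ())

  ⇒-elim : ∀ {A B} → Holds v (A ⇒ B) → Holds v A → Holds v B
  ⇒-elim (holds h) (holds a) rewrite a = holds h

  ⇒-intro : ∀ {A B} → (Holds v A → Holds v B) → Holds v (A ⇒ B)
  ⇒-intro {A} {B} f = holds (by-value (evalB v A) refl)
    where
    by-value : ∀ b → evalB v A ≡ b → (if b then evalB v B else true) ≡ true
    by-value true  a = Holds.truth (f (holds a))
    by-value false _ = refl

  decide : ∀ A → Dec (Holds v A)
  decide A with evalB v A ≟ true
  ... | yes a = yes (holds a)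
  ... | no ¬a = no (λ a → ¬a (Holds.truth a))

  stable : ∀ {A} → ¬ ¬ Holds v A → Holds v A
  stable {A} ¬¬a with decide A
  ... | yes a = a
  ... | no ¬a = ⊥-elim (¬¬a ¬a)

  ¬-intro : ∀ {A} → ¬ Holds v A → Holds v (¬' A)
  ¬-intro ¬a = ⇒-intro (λ a → ⊥-elim (¬a a))

  ¬-elim : ∀ {A} → Holds v (¬' A) → ¬ Holds v A
  ¬-elim h a = ⊥-fails (⇒-elim h a)

  ¬¬-intro : ∀ {A} → Holds v A → Holds v (¬' (¬' A))
  ¬¬-intro a = ¬-intro (λ n → ¬-elim n a)

  ¬¬-elim : ∀ {A} → Holds v (¬' (¬' A)) → Holds v A
  ¬¬-elim h = stable (λ ¬a → ¬-elim h (¬-intro ¬a))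

  ∧-intro : ∀ {A B} → Holds v A → Holds v B → Holds v (A ∧' B)
  ∧-intro a b = ¬-intro (λ f → ¬-elim (⇒-elim f a) b)

  ∧-elim : ∀ {A B} → Holds v (A ∧' B) → Holds v A × Holds v B
  ∧-elim h = stable (λ ¬a → ¬-elim h (⇒-intro (λ a → ⊥-elim (¬a a))))
           , stable (λ ¬b → ¬-elim h (⇒-intro (λ _ → ¬-intro ¬b)))

  ⋀-intro : ∀ {L} → All (Holds v) L → Holds v (⋀ L)
  ⋀-intro []       = holds refl
  ⋀-intro (a ∷ as) = ∧-intro a (⋀-intro as)

  ⋀-elim : ∀ L → Holds v (⋀ L) → All (Holds v) L
  ⋀-elim []      _ = []
  ⋀-elim (A ∷ L) h = proj₁ (∧-elim h) ∷ ⋀-elim L (proj₂ (∧-elim h))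

  ⋁¬-intro : ∀ {L} → Any (λ σ → ¬ Holds v σ) L → Holds v (⋁¬ L)
  ⋁¬-intro (here ¬s) = ⇒-intro (λ nn → ⊥-elim (¬s (¬¬-elim nn)))
  ⋁¬-intro (there a) = ⇒-intro (λ _ → ⋁¬-intro a)

  ⋁¬-elim : ∀ L → Holds v (⋁¬ L) → Any (λ σ → ¬ Holds v σ) L
  ⋁¬-elim []      h = ⊥-elim (⊥-fails h)
  ⋁¬-elim (σ ∷ L) h with decide σ
  ... | yes s = there (⋁¬-elim L (⇒-elim h (¬¬-intro s)))
  ... | no ¬s = here ¬s

deduction : ∀ {A L B} → (A ∷ L) ⊨ B → L ⊨ A ⇒ B
deduction e v hs = ⇒-intro (λ a → e v (a ∷ hs))

⋁¬-++ˡ : ∀ K R → (⋁¬ K ∷ []) ⊨ ⋁¬ (K ++ R)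
⋁¬-++ˡ K R v (h ∷ []) = ⋁¬-intro (Any.++⁺ˡ (⋁¬-elim K h))

⋁¬-++ʳ : ∀ K R → (⋁¬ R ∷ []) ⊨ ⋁¬ (K ++ R)
⋁¬-++ʳ K R v (h ∷ []) = ⋁¬-intro (Any.++⁺ʳ K (⋁¬-elim R h))

discharge : ∀ {Γ : FSet} {B} L → All (λ F → F ∈ Γ ⊎ F ≡ B) L →
  Σ (List Formula) λ K → All (_∈ Γ) K ×
    (∀ v → Holds v B → All (Holds v) K → All (Holds v) L)
discharge [] [] = [] , [] , λ _ _ _ → []
discharge (F ∷ L) (inj₁ F∈Γ ∷ ps) with discharge L ps
... | K , K⊆Γ , recover = F ∷ K , F∈Γ ∷ K⊆Γ , λ { v b (f ∷ k) → f ∷ recover v b k }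
discharge (F ∷ L) (inj₂ refl ∷ ps) with discharge L ps
... | K , K⊆Γ , recover = K , K⊆Γ , λ v b k → b ∷ recover v b k

module Theorems {X : FSet} (IL : ExtendsIL X) where
  open ExtendsIL IL

  derive : ∀ {L B} → All (_∈ X) L → L ⊨ B → B ∈ X
  derive {[]}    []       e = taut _ (λ v → Holds.truth (e v []))
  derive {_ ∷ _} (a ∷ as) e = MP _ _ (derive as (deduction e)) a

  tautology : ∀ {A B} → (A ∷ []) ⊨ B → (A ⇒ B) ∈ X
  tautology e = derive [] (deduction e)

  J1-rule : ∀ {A B} → (A ⇒ B) ∈ X → (A ▷ B) ∈ X
  J1-rule h = MP _ _ (J1 _ _) (Nec _ h)

  tautology-▷ : ∀ {A B} → (A ∷ []) ⊨ B → (A ▷ B) ∈ X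
  tautology-▷ e = J1-rule (tautology e)

  □-mono : ∀ {A B} → (A ∷ []) ⊨ B → (□ A ⇒ □ B) ∈ X
  □-mono e = MP _ _ (K _ _) (Nec _ (tautology e))

  curry : ∀ {A B C} → (A ∧' B ⇒ C) ∈ X → (A ⇒ (B ⇒ C)) ∈ X
  curry h = derive (h ∷ [])
    λ { v (f ∷ []) → ⇒-intro λ a → ⇒-intro λ b → ⇒-elim f (∧-intro a b) }

  ¬□▷◇¬ : ∀ A → (¬' (□ A) ▷ ◇ (¬' A)) ∈ X
  ¬□▷◇¬ A = J1-rule (derive (□-mono {¬' (¬' A)} {A} (λ { v (h ∷ []) → ¬¬-elim h }) ∷ [])
    λ { v (f ∷ []) → ⇒-intro λ n → ¬-intro λ b → ¬-elim n (⇒-elim f b) })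

module Maximal {X : FSet} (IL : ExtendsIL X) where
  open ExtendsIL IL
  open Theorems IL

  -- An MCS contains everything X-provably implied by finitely many members:
  -- adding the consequence keeps the set consistent, so maximality applies.
  closed : ∀ {Γ} → MCS X Γ → ∀ {L B} → All (_∈ Γ) L → (⋀ L ⇒ B) ∈ X → B ∈ Γ
  closed {Γ} (consistent , maximal) {L} {B} L⊆Γ L⇒B =
    maximal Γ+B (λ _ → inj₁) consistent+B B (inj₂ refl)
    where
    Γ+B : FSet
    Γ+B F = F ∈ Γ ⊎ F ≡ B

    consistent+B : Consistent X Γ+B
    consistent+B L' L'⊆Γ+B L'⇒⊥ with discharge L' L'⊆Γ+B
    ... | K , K⊆Γ , recover =
      consistent (L ++ K) (All.++⁺ L⊆Γ K⊆Γ) (derive (L⇒B ∷ L'⇒⊥ ∷ []) refute)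
      where
      refute : ((⋀ L ⇒ B) ∷ (⋀ L' ⇒ ⊥') ∷ []) ⊨ ⋀ (L ++ K) ⇒ ⊥'
      refute v (f ∷ g ∷ []) = ⇒-intro λ h →
        let hL , hK = All.++⁻ L (⋀-elim (L ++ K) h)
        in ⇒-elim g (⋀-intro (recover v (⇒-elim f (⋀-intro hL)) hK))

  theorem : ∀ {Γ A} → MCS X Γ → A ∈ X → A ∈ Γ
  theorem M h = closed M [] (derive (h ∷ []) λ { v (a ∷ []) → ⇒-intro (λ _ → a) })

  mp₁ : ∀ {Γ A B} → MCS X Γ → (A ⇒ B) ∈ X → A ∈ Γ → B ∈ Γ
  mp₁ {A = A} M h a = closed M (a ∷ []) (derive (h ∷ [])
    λ { v (f ∷ []) → ⇒-intro λ c → ⇒-elim f (All.head (⋀-elim (A ∷ []) c)) })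

  mp₂ : ∀ {Γ A B C} → MCS X Γ → (A ⇒ (B ⇒ C)) ∈ X → A ∈ Γ → B ∈ Γ → C ∈ Γ
  mp₂ {A = A} {B} {C} M h a b = closed M (a ∷ b ∷ []) (derive (h ∷ [])
    λ { v (f ∷ []) → ⇒-intro λ c → apply v f (⋀-elim (A ∷ B ∷ []) c) })
    where
    apply : ∀ v → Holds v (A ⇒ (B ⇒ C)) → All (Holds v) (A ∷ B ∷ []) → Holds v C
    apply v f (x ∷ y ∷ []) = ⇒-elim (⇒-elim f x) y

  ▷-trans : ∀ {Γ A B C} → MCS X Γ → (A ▷ B) ∈ Γ → (B ▷ C) ∈ Γ → (A ▷ C) ∈ Γ
  ▷-trans M = mp₂ M (curry (J2 _ _ _))

  ▷-join : ∀ {Γ A B C} → MCS X Γ → (A ▷ C) ∈ Γ → (B ▷ C) ∈ Γ → ((A ∨' B) ▷ C) ∈ Γ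
  ▷-join M = mp₂ M (curry (J3 _ _ _))

  ▷-weaken : ∀ {Γ A B C} → MCS X Γ → (A ▷ B) ∈ Γ → (B ∷ []) ⊨ C → (A ▷ C) ∈ Γ
  ▷-weaken M h e = ▷-trans M h (theorem M (tautology-▷ e))

  -- □F yields ¬F ▷ ⊥, i.e. ¬F ▷ ⋁¬[] (via □¬¬F and J1).
  □⇒¬▷⊥ : ∀ {Γ F} → MCS X Γ → □ F ∈ Γ → (¬' F ▷ ⊥') ∈ Γ
  □⇒¬▷⊥ M b = mp₁ M (J1 _ _) (mp₁ M (□-mono λ { v (f ∷ []) → ¬¬-intro f }) b)

module Accessibility {X : FSet} (IL : ExtendsIL X) where
  open Theorems IL
  open Maximal IL

  ≺-box : ∀ {Γ Λ S F} → MCS X Γ → Γ ≺[ S ] Λ → □ F ∈ Γ → F ∈ Λ × □ F ∈ Λ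
  ≺-box M R b = R _ [] [] (□⇒¬▷⊥ M b)

  ≺-▷ : ∀ {Γ Λ S A B} → ContainsP X → MCS X Γ → Γ ≺[ S ] Λ → (A ▷ B) ∈ Γ → (A ▷ B) ∈ Λ
  ≺-▷ P M R h = proj₁ (≺-box M R (mp₁ M (P _ _) h))

  -- The members of S are boxed in every ≺_S-successor (use ¬σ ▷ ¬σ).
  ≺-S : ∀ {Γ Λ S σ} → MCS X Γ → Γ ≺[ S ] Λ → σ ∈ S → □ σ ∈ Λ
  ≺-S {σ = σ} M R s = proj₂ (R σ (σ ∷ []) (s ∷ []) (theorem M (tautology-▷
    λ { v (n ∷ []) → ⋁¬-intro {L = σ ∷ []} (here (¬-elim n)) })))

module Reduction {X : FSet} (IL : ExtendsIL X) {Λ : FSet} (MΛ : MCS X Λ) (T : FSet) where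
  open ExtendsIL IL using (J5)
  open Theorems IL
  open Maximal IL

  Reduces : Formula → Set
  Reduces F = Σ (List Formula) λ T' → All (_∈ T) T' × (F ▷ ⋁¬ T') ∈ Λ

  boxed-reduces : ∀ {σ} → □ σ ∈ Λ → Reduces (¬' σ)
  boxed-reduces b = [] , [] , □⇒¬▷⊥ MΛ b

  -- Members of Λ^⊡_T reduce; for □B use ¬□B ▷ ◇¬B ▷ ¬B.
  boxdot-reduces : ∀ {σ} → σ ∈ boxdot Λ T → Reduces (¬' σ)
  boxdot-reduces (B , T' , T'⊆T , h , inj₁ refl) = T' , T'⊆T , h
  boxdot-reduces (B , T' , T'⊆T , h , inj₂ refl) =
    T' , T'⊆T , ▷-trans MΛ (theorem MΛ (¬□▷◇¬ B)) (▷-trans MΛ (theorem MΛ (J5 (¬' B))) h)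

  ⋁¬-reduces : ∀ {L} → All (λ σ → Reduces (¬' σ)) L → Reduces (⋁¬ L)
  ⋁¬-reduces [] = [] , [] , theorem MΛ (tautology-▷ λ { v (f ∷ []) → f })
  ⋁¬-reduces ((K , K⊆T , hK) ∷ rs) with ⋁¬-reduces rs
  ... | R , R⊆T , hR = K ++ R , All.++⁺ K⊆T R⊆T ,
    ▷-join MΛ (▷-weaken MΛ hK (⋁¬-++ˡ K R)) (▷-weaken MΛ hR (⋁¬-++ʳ K R))

lemma6p1 : (X : FSet) → ExtendsIL X → ContainsP X →
    (Γ Λ Δ S T : FSet) → MCS X Γ → MCS X Λ → MCS X Δ →
    Γ ≺[ S ] Λ → Λ ≺[ T ] Δ → Γ ≺[ S ∪ boxdot Λ T ] Δ
lemma6p1 X IL P Γ Λ Δ S T MΓ MΛ _ Γ≺Λ Λ≺Δ A S' S'⊆ h =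
  conclude (⋁¬-reduces (All.map reduce S'⊆))
  where
  open Maximal IL using (▷-trans)
  open Accessibility IL
  open Reduction IL MΛ T

  reduce : ∀ {σ} → σ ∈ (S ∪ boxdot Λ T) → Reduces (¬' σ)
  reduce (inj₁ σ∈S)  = boxed-reduces (≺-S MΓ Γ≺Λ σ∈S)
  reduce (inj₂ σ∈Λ⊡) = boxdot-reduces σ∈Λ⊡

  -- ¬A ▷ ⋁¬S' reaches Λ by P; compose with the reduction and apply Λ ≺_T Δ.
  conclude : Reduces (⋁¬ S') → A ∈ Δ × □ A ∈ Δ
  conclude (T' , T'⊆T , red) = Λ≺Δ A T' T'⊆T (▷-trans MΛ (≺-▷ P MΓ Γ≺Λ h) red)
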